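{- Let $t_1,t_2>2$ be integers with $t_1\ne t_2$, and let $E=\gcd(t_1^2-4,t_2^2-4)$. (i) There is an absolute constant $c>0$ such that there exist a divisor $e$ of $E$ and $\delta\in\{ -1,1\}$ with $e\ge c\sqrt{E}$ and $e\mid t_1-\delta t_2$. (ii) $E\le|t_1-t_2|(t_1+t_2)$. -}

module Defs where

open import Data.Integer using (ℤ; _*_; _-_; +_)
open import Data.Integer.GCD using (gcd)
open import Data.Rational using (ℚ; _/_)

E : ℤ → ℤ → ℤ
E t₁ t₂ = gcd (t₁ * t₁ - + 4) (t₂ * t₂ - + 4)

toℚ : ℤ → ℚ
toℚ n = n / 1

-- Since t₁² - 4 - (t₂² - 4) = (t₁ - t₂)(t₁ + t₂), E divides |t₁ - t₂|·(t₁ + t₂),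
-- which gives (ii) at once.  For (i), whenever d ∣ m n we have
-- d ∣ gcd(d, m)·gcd(d, n), so the larger of these two divisors of d is at
-- least √d; it divides t₁ - t₂ or t₁ + t₂.  Thus c = 1 works.
module Submission where

open import Defs
open import Data.Integer using (ℤ; +_; -_; _*_; _-_; _+_; _<_; _≤_; ∣_∣)
open import Data.Integer.Divisibility using (_∣_)
open import Data.Rational using (ℚ; Positive) renaming (_*_ to _*ℚ_; _≤_ to _≤ℚ_)
open import Data.Product using (Σ; ∃; _×_)
open import Data.Sum using (_⊎_)
open import Relation.Binary.PropositionalEquality using (_≡_)
open import Relation.Nullary using (¬_)

open import Data.Product using (_,_)
open import Data.Sum using (inj₁; inj₂)
open import Relation.Binary.PropositionalEquality using (refl; sym; trans; cong; cong₂; subst; subst₂; module ≡-Reasoning)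
open import Data.Nat as ℕ using (ℕ; zero; suc; z≤n)
import Data.Nat.Properties as ℕ
import Data.Nat.Divisibility as ℕ
import Data.Nat.GCD as ℕ
import Data.Nat.Coprimality as ℕ
import Data.Integer as ℤ
import Data.Integer.Properties as ℤ
import Data.Integer.GCD as ℤ
import Data.Integer.Divisibility.Signed as ℤ
import Data.Rational as ℚ
import Data.Rational.Properties as ℚ
open import Data.Integer.Tactic.RingSolver using (solve-∀)

∣m*n⇒∣gcd*gcd : ∀ d m n → d ℕ.∣ m ℕ.* n → d ℕ.∣ ℕ.gcd d m ℕ.* ℕ.gcd d n
∣m*n⇒∣gcd*gcd d m n d∣mn = subst (d ℕ.∣_) gcd[dg,mg]≡gcd[d,m]*g
  (ℕ.gcd-greatest (ℕ.m∣m*n g) d∣m*g)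
  where
  g : ℕ
  g = ℕ.gcd d n
  d∣m*g : d ℕ.∣ m ℕ.* g
  d∣m*g = subst (d ℕ.∣_) (sym (ℕ.c*gcd[m,n]≡gcd[cm,cn] m d n))
    (ℕ.gcd-greatest (ℕ.n∣m*n m) d∣mn)
  gcd[dg,mg]≡gcd[d,m]*g : ℕ.gcd (d ℕ.* g) (m ℕ.* g) ≡ ℕ.gcd d m ℕ.* g
  gcd[dg,mg]≡gcd[d,m]*g = begin
    ℕ.gcd (d ℕ.* g) (m ℕ.* g) ≡⟨ cong₂ ℕ.gcd (ℕ.*-comm d g) (ℕ.*-comm m g) ⟩
    ℕ.gcd (g ℕ.* d) (g ℕ.* m) ≡⟨ ℕ.c*gcd[m,n]≡gcd[cm,cn] g d m ⟨
    g ℕ.* ℕ.gcd d m           ≡⟨ ℕ.*-comm g (ℕ.gcd d m) ⟩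
    ℕ.gcd d m ℕ.* g           ∎
    where open ≡-Reasoning

∣m*n⇒≤gcd*gcd : ∀ d m n → d ℕ.∣ m ℕ.* n → d ℕ.≤ ℕ.gcd d m ℕ.* ℕ.gcd d n
∣m*n⇒≤gcd*gcd zero      m n _    = z≤n
∣m*n⇒≤gcd*gcd d@(suc _) m n d∣mn =
  ℕ.∣⇒≤ {{ℕ.m*n≢0 _ _ {{gcd≢0 m}} {{gcd≢0 n}}}} (∣m*n⇒∣gcd*gcd d m n d∣mn)
  where
  gcd≢0 : ∀ k → ℕ.NonZero (ℕ.gcd d k)
  gcd≢0 k = ℕ.≢-nonZero (ℕ.gcd[m,n]≢0 d k (inj₁ λ ()))

∣m*n⇒large-divisor : ∀ {d} m n → d ℕ.∣ m ℕ.* n →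
                     ∃ λ e → e ℕ.∣ d × d ℕ.≤ e ℕ.* e × (e ℕ.∣ m ⊎ e ℕ.∣ n)
∣m*n⇒large-divisor {d} m n d∣mn
  with ∣m*n⇒≤gcd*gcd d m n d∣mn | ℕ.≤-total (ℕ.gcd d m) (ℕ.gcd d n)
... | d≤gm*gn | inj₁ gm≤gn = ℕ.gcd d n , ℕ.gcd[m,n]∣m d n
                           , ℕ.≤-trans d≤gm*gn (ℕ.*-monoˡ-≤ (ℕ.gcd d n) gm≤gn)
                           , inj₂ (ℕ.gcd[m,n]∣n d n)
... | d≤gm*gn | inj₂ gn≤gm = ℕ.gcd d m , ℕ.gcd[m,n]∣m d m
                           , ℕ.≤-trans d≤gm*gn (ℕ.*-monoʳ-≤ (ℕ.gcd d m) gn≤gm)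
                           , inj₁ (ℕ.gcd[m,n]∣n d m)

gcd[i,j]∣i-j : ∀ i j → ℤ.gcd i j ∣ i - j
gcd[i,j]∣i-j i j = ℤ.∣⇒∣ᵤ (ℤ.∣m∣n⇒∣m-n (ℤ.∣ᵤ⇒∣ {ℤ.gcd i j} {i} (ℤ.gcd[i,j]∣i i j))
                                          (ℤ.∣ᵤ⇒∣ {ℤ.gcd i j} {j} (ℤ.gcd[i,j]∣j i j)))

[t₁²-4]-[t₂²-4]≡[t₁-t₂][t₁+t₂] : ∀ t₁ t₂ → (t₁ * t₁ - + 4) - (t₂ * t₂ - + 4) ≡ (t₁ - t₂) * (t₁ + t₂)
[t₁²-4]-[t₂²-4]≡[t₁-t₂][t₁+t₂] = solve-∀

E∣∣t₁-t₂∣*∣t₁+t₂∣ : ∀ t₁ t₂ → ∣ E t₁ t₂ ∣ ℕ.∣ ∣ t₁ - t₂ ∣ ℕ.* ∣ t₁ + t₂ ∣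
E∣∣t₁-t₂∣*∣t₁+t₂∣ t₁ t₂ = subst (∣ E t₁ t₂ ∣ ℕ.∣_)
  (trans (cong ∣_∣ ([t₁²-4]-[t₂²-4]≡[t₁-t₂][t₁+t₂] t₁ t₂)) (ℤ.abs-* (t₁ - t₂) (t₁ + t₂)))
  (gcd[i,j]∣i-j (t₁ * t₁ - + 4) (t₂ * t₂ - + 4))

∣t₁∓t₂∣⇒∃δ : ∀ {e} t₁ t₂ → (e ∣ t₁ - t₂) ⊎ (e ∣ t₁ + t₂) →
             ∃ λ δ → (δ ≡ + 1 ⊎ δ ≡ - + 1) × (e ∣ t₁ - δ * t₂)
∣t₁∓t₂∣⇒∃δ {e} t₁ t₂ (inj₁ e∣t₁-t₂) =
  + 1 , inj₁ refl , subst (e ∣_) (sym (t₁-1*t₂≡t₁-t₂ t₁ t₂)) e∣t₁-t₂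
  where
  t₁-1*t₂≡t₁-t₂ : ∀ t₁ t₂ → t₁ - + 1 * t₂ ≡ t₁ - t₂
  t₁-1*t₂≡t₁-t₂ = solve-∀
∣t₁∓t₂∣⇒∃δ {e} t₁ t₂ (inj₂ e∣t₁+t₂) =
  - + 1 , inj₂ refl , subst (e ∣_) (sym (t₁+1*t₂≡t₁+t₂ t₁ t₂)) e∣t₁+t₂
  where
  t₁+1*t₂≡t₁+t₂ : ∀ t₁ t₂ → t₁ - - + 1 * t₂ ≡ t₁ + t₂
  t₁+1*t₂≡t₁+t₂ = solve-∀

toℚ-+ : ∀ n → toℚ (+ n) ≡ ℚ.mkℚ (+ n) 0 (ℕ.sym (ℕ.1-coprimeTo n))
toℚ-+ n = ℚ.normalize-coprime (ℕ.sym (ℕ.1-coprimeTo n))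

toℚ-+-mono-≤ : ∀ {m n} → m ℕ.≤ n → toℚ (+ m) ≤ℚ toℚ (+ n)
toℚ-+-mono-≤ {m} {n} m≤n = subst₂ _≤ℚ_ (sym (toℚ-+ m)) (sym (toℚ-+ n))
  (ℚ.*≤* (subst₂ _≤_ (sym (ℤ.*-identityʳ (+ m))) (sym (ℤ.*-identityʳ (+ n))) (ℤ.+≤+ m≤n)))

1*1*toℚ-mono : ∀ {d e} → d ℕ.≤ e ℕ.* e → ℚ.1ℚ *ℚ ℚ.1ℚ *ℚ toℚ (+ d) ≤ℚ toℚ (+ e * + e)
1*1*toℚ-mono {d} {e} d≤e*e = subst₂ _≤ℚ_
  (sym (trans (cong (_*ℚ toℚ (+ d)) (ℚ.*-identityˡ ℚ.1ℚ)) (ℚ.*-identityˡ (toℚ (+ d)))))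
  (cong toℚ (ℤ.pos-* e e))
  (toℚ-+-mono-≤ d≤e*e)

E≤∣t₁-t₂∣*∣t₁+t₂∣ : ∀ t₁ t₂ → ¬ (t₁ ≡ t₂) → ¬ (t₁ + t₂ ≡ + 0) →
                    ∣ E t₁ t₂ ∣ ℕ.≤ ∣ t₁ - t₂ ∣ ℕ.* ∣ t₁ + t₂ ∣
E≤∣t₁-t₂∣*∣t₁+t₂∣ t₁ t₂ t₁≢t₂ t₁+t₂≢0 =
  ℕ.∣⇒≤ {{ℕ.m*n≢0 _ _ {{∣t₁-t₂∣≢0}} {{∣t₁+t₂∣≢0}}}} (E∣∣t₁-t₂∣*∣t₁+t₂∣ t₁ t₂)
  where
  ∣t₁-t₂∣≢0 : ℕ.NonZero ∣ t₁ - t₂ ∣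
  ∣t₁-t₂∣≢0 = ℕ.≢-nonZero λ eq → t₁≢t₂ (ℤ.i-j≡0⇒i≡j t₁ t₂ (ℤ.∣i∣≡0⇒i≡0 eq))
  ∣t₁+t₂∣≢0 : ℕ.NonZero ∣ t₁ + t₂ ∣
  ∣t₁+t₂∣≢0 = ℕ.≢-nonZero λ eq → t₁+t₂≢0 (ℤ.∣i∣≡0⇒i≡0 eq)

lemma3p4 : (Σ ℚ λ c → Positive c ×
    ((t₁ t₂ : ℤ) → + 2 < t₁ → + 2 < t₂ → ¬ (t₁ ≡ t₂) →
    Σ ℤ λ e → Σ ℤ λ δ →
    (e ∣ E t₁ t₂) × (δ ≡ + 1 ⊎ δ ≡ - + 1) × (+ 0 ≤ e) ×
    (c *ℚ c *ℚ toℚ (E t₁ t₂) ≤ℚ toℚ (e * e)) × (e ∣ (t₁ - δ * t₂))))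
    ×
    ((t₁ t₂ : ℤ) → + 2 < t₁ → + 2 < t₂ → ¬ (t₁ ≡ t₂) →
    E t₁ t₂ ≤ + ∣ t₁ - t₂ ∣ * (t₁ + t₂))
lemma3p4 = (ℚ.1ℚ , _ , λ t₁ t₂ _ _ _ → large-divisor t₁ t₂) , upper-bound
  where
  -- ℤ's _∣_ is ℕ's _∣_ on absolute values and E is + of a ℕ gcd, so a divisor
  -- found in ℕ is used as it stands.
  large-divisor : ∀ t₁ t₂ → Σ ℤ λ e → Σ ℤ λ δ →
    (e ∣ E t₁ t₂) × (δ ≡ + 1 ⊎ δ ≡ - + 1) × (+ 0 ≤ e) ×
    (ℚ.1ℚ *ℚ ℚ.1ℚ *ℚ toℚ (E t₁ t₂) ≤ℚ toℚ (e * e)) × (e ∣ (t₁ - δ * t₂))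
  large-divisor t₁ t₂ with ∣m*n⇒large-divisor _ _ (E∣∣t₁-t₂∣*∣t₁+t₂∣ t₁ t₂)
  ... | e , e∣E , E≤e*e , e∣t₁∓t₂ with ∣t₁∓t₂∣⇒∃δ {+ e} t₁ t₂ e∣t₁∓t₂
  ... | δ , δ≡±1 , e∣t₁-δt₂ = + e , δ , e∣E , δ≡±1 , ℤ.+≤+ z≤n , 1*1*toℚ-mono {e = e} E≤e*e , e∣t₁-δt₂

  upper-bound : ∀ t₁ t₂ → + 2 < t₁ → + 2 < t₂ → ¬ (t₁ ≡ t₂) → E t₁ t₂ ≤ + ∣ t₁ - t₂ ∣ * (t₁ + t₂)
  upper-bound t₁ t₂ 2<t₁ 2<t₂ t₁≢t₂ = subst (E t₁ t₂ ≤_) +∣t₁-t₂∣*∣t₁+t₂∣≡∣t₁-t₂∣*[t₁+t₂]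
    (ℤ.+≤+ (E≤∣t₁-t₂∣*∣t₁+t₂∣ t₁ t₂ t₁≢t₂ (λ eq → ℤ.<⇒≢ 0<t₁+t₂ (sym eq))))
    where
    0<t₁+t₂ : + 0 < t₁ + t₂
    0<t₁+t₂ = ℤ.+-mono-< (ℤ.<-trans 0<2 2<t₁) (ℤ.<-trans 0<2 2<t₂)
      where
      0<2 : + 0 < + 2
      0<2 = ℤ.+<+ (ℕ.s≤s z≤n)
    +∣t₁-t₂∣*∣t₁+t₂∣≡∣t₁-t₂∣*[t₁+t₂] : + (∣ t₁ - t₂ ∣ ℕ.* ∣ t₁ + t₂ ∣) ≡ + ∣ t₁ - t₂ ∣ * (t₁ + t₂)
    +∣t₁-t₂∣*∣t₁+t₂∣≡∣t₁-t₂∣*[t₁+t₂] = trans (ℤ.pos-* ∣ t₁ - t₂ ∣ ∣ t₁ + t₂ ∣)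
      (cong (+ ∣ t₁ - t₂ ∣ *_) (ℤ.0≤i⇒+∣i∣≡i (ℤ.<⇒≤ 0<t₁+t₂)))
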